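{- Let $S=\frac{13591409}{545140134}$, $\varepsilon=\frac{1728}{640320^{3}}=53360^{ -3}$, and for integers $k\ge 0$ let $$s_k=\frac{(6k)!}{(3k)!\,(k!)^3}\cdot\frac{k+S}{640320^{3k}}.$$ Put $$a_1=\frac{\varepsilon}{2(1+\varepsilon)}=\frac{1}{303862746112002},\qquad a_2=\frac{S\varepsilon}{1+\varepsilon}-\frac{23\varepsilon-4\varepsilon^2}{36(1+\varepsilon)^2}=-\frac{62186213362465}{15388761412454497761254741334}.$$ For every integer $n\ge 1$ define $e_n$ by $$\left|\sum_{k=n}^{\infty}(-1)^k s_k\right|=\frac{s_n}{1+\varepsilon}\left(1+\frac{a_1}{n}+\frac{a_2}{n^2}+\frac{e_n\varepsilon}{n^3}\right).$$ Then $0.3216<e_n<0.6704$ for all $n\ge 1$.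
   Context: $s_k$ are (up to the factor $(-1)^k$) the terms of the Chudnovsky series $\frac{\sqrt{640320^3}}{12\pi}=\sum_{k\ge0}\frac{(-1)^k(6k)!}{(3k)!(k!)^3}\frac{13591409+545140134k}{640320^{3k}}$. -}

module Defs where

open import Data.Nat as ℕ using (ℕ; zero; suc; NonZero; _!)
open import Data.Nat.Properties using (m*n≢0; m^n≢0; _!≢0; m+1+n≢0)
open import Data.Integer using (ℤ; +_; -[1+_])
open import Data.Rational using (ℚ; _/_; _+_; _-_; _*_; -_; ∣_∣; _≤_; _<_; 0ℚ; 1ℚ)
open import Data.Product using (Σ; _×_; ∃-syntax)

-- numerator / denominator of s_k = (6k)!/((3k)!(k!)^3) * (k + S)/640320^(3k),
-- with k + S = (545140134 k + 13591409) / 545140134.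
sNum : ℕ → ℕ
sNum k = (6 ℕ.* k) ! ℕ.* (545140134 ℕ.* k ℕ.+ 13591409)

sDen : ℕ → ℕ
sDen k = (3 ℕ.* k) ! ℕ.* ((k !) ℕ.^ 3) ℕ.* (640320 ℕ.^ (3 ℕ.* k)) ℕ.* 545140134

sNum≢0 : ∀ k → NonZero (sNum k)
sNum≢0 k = m*n≢0 ((6 ℕ.* k) !) _ {{(6 ℕ.* k) !≢0}} {{nz}}
  where
  nz : NonZero (545140134 ℕ.* k ℕ.+ 13591409)
  nz = ℕ.≢-nonZero (m+1+n≢0 (545140134 ℕ.* k) {13591408})

sDen≢0 : ∀ k → NonZero (sDen k)
sDen≢0 k = m*n≢0 _ 545140134 {{m*n≢0 _ _ {{m*n≢0 _ _ {{(3 ℕ.* k) !≢0}} {{m^n≢0 (k !) 3 {{k !≢0}}}}}} {{m^n≢0 640320 (3 ℕ.* k)}}}}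

s : ℕ → ℚ
s k = (+ sNum k / sDen k) {{sDen≢0 k}}

sInv : ℕ → ℚ
sInv k = (+ sDen k / sNum k) {{sNum≢0 k}}

ε : ℚ
ε = + 1728 / (640320 ℕ.^ 3)

εInv : ℚ
εInv = + (640320 ℕ.^ 3) / 1728

a₁ : ℚ
a₁ = + 1 / 303862746112002

a₂ : ℚ
a₂ = - (+ 62186213362465 / 15388761412454497761254741334)

sgn : ℕ → ℚ
sgn zero = 1ℚ
sgn (suc k) = - sgn k

partialTail : ℕ → ℕ → ℚ
partialTail n zero = sgn n * s n
partialTail n (suc m) = partialTail n m + sgn (n ℕ.+ suc m) * s (n ℕ.+ suc m)

-- approximant of e_n obtained by replacing the tail by its partial sum up to n+m:
-- e_n = ( |tail| (1+ε) / s_n - 1 - a₁/n - a₂/n² ) n³ / ε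
eApprox : (n : ℕ) → .{{NonZero n}} → ℕ → ℚ
eApprox n m =
  (∣ partialTail n m ∣ * (1ℚ + ε) * sInv n - 1ℚ - a₁ * (+ 1 / n) - a₂ * (+ 1 / (n ℕ.^ 2) ))
    * (+ (n ℕ.^ 3) / 1) * εInv
  where instance _ = m^n≢0 n 2

-- Strict order between a rational and the limit of a (convergent) rational sequence,
-- in the standard (Bishop) sense.
_<lim_ : ℚ → (ℕ → ℚ) → Set
L <lim q = ∃[ δ ] (0ℚ < δ × ∃[ M ] (∀ m → M ℕ.≤ m → L + δ ≤ q m))

_lim<_ : (ℕ → ℚ) → ℚ → Set
q lim< U = ∃[ δ ] (0ℚ < δ × ∃[ M ] (∀ m → M ℕ.≤ m → q m + δ ≤ U))

-- With r_k = s_{k+1} / s_k, the tail from n = t + 1 divided by (-1)^n s_n satisfies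
-- v_t = 1 - r_t v_{t+1}, and e_n is an affine function of v_t with slope (1 + ε) n³ / ε.
-- The rational functions L_t, U_t at which e_{t+1} equals 0.32161 and 0.67035 satisfy
-- L_t + r_t U_{t+1} ≤ 1 ≤ U_t + r_t L_{t+1}; as 0 ≤ r_t ≤ 1/2, every truncation of v_t then
-- lies in [L_t, U_t] up to an error that halves with each further term, so the approximants
-- of e_n end up in (0.3216, 0.6704) with margin 1/200000. The polynomial identities and
-- inequalities in t behind these facts are checked by normalising polynomials with natural
-- coefficients and comparing them coefficientwise.
module Submission where

open import Defs
open import Data.Nat using (ℕ; suc; NonZero)

module Polynomials where

  open import Data.Bool using (Bool; true; T; _∧_)
  open import Data.Bool.Properties using (T-∧)
  open import Data.List using (List; []; _∷_)
  open import Data.Nat using (zero; suc; _+_; _*_; _^_; _≤_; z≤n; _≤ᵇ_; _≡ᵇ_; >-nonZero)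
  open import Data.Nat.Properties
  open import Data.Nat.Tactic.RingSolver using (solve-∀)
  open import Data.Product using (_,_)
  open import Function.Bundles using (Equivalence)
  open import Relation.Binary.PropositionalEquality

  Poly : Set
  Poly = List ℕ

  eval : Poly → ℕ → ℕ
  eval []      x = 0
  eval (a ∷ p) x = a + x * eval p x

  infixl 6 _+ₚ_
  infixl 7 _*ₚ_ _·ₚ_

  _+ₚ_ : Poly → Poly → Poly
  []      +ₚ q       = q
  (a ∷ p) +ₚ []      = a ∷ p
  (a ∷ p) +ₚ (b ∷ q) = a + b ∷ p +ₚ q

  _·ₚ_ : ℕ → Poly → Poly
  c ·ₚ []      = []
  c ·ₚ (a ∷ p) = c * a ∷ c ·ₚ p

  _*ₚ_ : Poly → Poly → Poly
  []      *ₚ q = []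
  (a ∷ p) *ₚ q = a ·ₚ q +ₚ (0 ∷ p *ₚ q)

  _^ₚ_ : Poly → ℕ → Poly
  p ^ₚ zero  = 1 ∷ []
  p ^ₚ suc k = p *ₚ p ^ₚ k

  eval-+ₚ : ∀ p q x → eval (p +ₚ q) x ≡ eval p x + eval q x
  eval-+ₚ []      q       x = refl
  eval-+ₚ (a ∷ p) []      x = sym (+-identityʳ _)
  eval-+ₚ (a ∷ p) (b ∷ q) x = begin
    a + b + x * eval (p +ₚ q) x           ≡⟨ cong (λ e → a + b + x * e) (eval-+ₚ p q x) ⟩
    a + b + x * (eval p x + eval q x)     ≡⟨ regroup a b x (eval p x) (eval q x) ⟩
    a + x * eval p x + (b + x * eval q x) ∎
    where
    open ≡-Reasoning
    regroup : ∀ a b x u w → a + b + x * (u + w) ≡ a + x * u + (b + x * w)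
    regroup = solve-∀

  eval-·ₚ : ∀ c p x → eval (c ·ₚ p) x ≡ c * eval p x
  eval-·ₚ c []      x = sym (*-zeroʳ c)
  eval-·ₚ c (a ∷ p) x = begin
    c * a + x * eval (c ·ₚ p) x ≡⟨ cong (λ e → c * a + x * e) (eval-·ₚ c p x) ⟩
    c * a + x * (c * eval p x)  ≡⟨ regroup c a x (eval p x) ⟩
    c * (a + x * eval p x)      ∎
    where
    open ≡-Reasoning
    regroup : ∀ c a x u → c * a + x * (c * u) ≡ c * (a + x * u)
    regroup = solve-∀

  eval-*ₚ : ∀ p q x → eval (p *ₚ q) x ≡ eval p x * eval q x
  eval-*ₚ []      q x = refl
  eval-*ₚ (a ∷ p) q x = begin
    eval (a ·ₚ q +ₚ (0 ∷ p *ₚ q)) x          ≡⟨ eval-+ₚ (a ·ₚ q) (0 ∷ p *ₚ q) x ⟩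
    eval (a ·ₚ q) x + x * eval (p *ₚ q) x    ≡⟨ cong₂ (λ u w → u + x * w) (eval-·ₚ a q x) (eval-*ₚ p q x) ⟩
    a * eval q x + x * (eval p x * eval q x) ≡⟨ regroup a x (eval p x) (eval q x) ⟩
    (a + x * eval p x) * eval q x            ∎
    where
    open ≡-Reasoning
    regroup : ∀ a x u w → a * w + x * (u * w) ≡ (a + x * u) * w
    regroup = solve-∀

  eval-^ₚ : ∀ p k x → eval (p ^ₚ k) x ≡ eval p x ^ k
  eval-^ₚ p zero    x = cong (1 +_) (*-zeroʳ x)
  eval-^ₚ p (suc k) x = trans (eval-*ₚ p (p ^ₚ k) x) (cong (eval p x *_) (eval-^ₚ p k x))

  _≤ᶜ_ : Poly → Poly → Bool
  []      ≤ᶜ q       = true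
  (a ∷ p) ≤ᶜ []      = (a ≡ᵇ 0) ∧ (p ≤ᶜ [])
  (a ∷ p) ≤ᶜ (b ∷ q) = (a ≤ᵇ b) ∧ (p ≤ᶜ q)

  -- Coefficientwise comparison is sound because the variable ranges over ℕ.
  eval-mono-≤ᶜ : ∀ p q → T (p ≤ᶜ q) → ∀ x → eval p x ≤ eval q x
  eval-mono-≤ᶜ []      q       _ x = z≤n
  eval-mono-≤ᶜ (a ∷ p) []      h x with Equivalence.to T-∧ h
  ... | a≡0 , p≤0 rewrite ≡ᵇ⇒≡ a 0 a≡0 = begin
    x * eval p x ≤⟨ *-monoʳ-≤ x (eval-mono-≤ᶜ p [] p≤0 x) ⟩
    x * 0        ≡⟨ *-zeroʳ x ⟩
    0            ∎
    where open ≤-Reasoning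
  eval-mono-≤ᶜ (a ∷ p) (b ∷ q) h x with Equivalence.to T-∧ h
  ... | a≤b , p≤q = +-mono-≤ (≤ᵇ⇒≤ a b a≤b) (*-monoʳ-≤ x (eval-mono-≤ᶜ p q p≤q x))

  constant : Poly → ℕ
  constant []      = 0
  constant (a ∷ p) = a

  constant≤eval : ∀ p x → constant p ≤ eval p x
  constant≤eval []      x = z≤n
  constant≤eval (a ∷ p) x = m≤m+n a (x * eval p x)

  infixl 6 _⊕_ _+ₑ_
  infixl 7 _⊗_ _*ₑ_
  infixr 8 _^ₑ_

  -- Opaque, so that the type checker never unfolds a product with a large literal
  -- factor into iterated additions while comparing evaluated polynomials.
  opaque
    _⊕_ _⊗_ : ℕ → ℕ → ℕ
    _⊕_ = _+_
    _⊗_ = _*_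

    ⊕-def : ∀ a b → a ⊕ b ≡ a + b
    ⊕-def a b = refl

    ⊗-def : ∀ a b → a ⊗ b ≡ a * b
    ⊗-def a b = refl

  data Expr : Set where
    var  : Expr
    lit  : ℕ → Expr
    sucₑ : Expr → Expr
    _+ₑ_ : Expr → Expr → Expr
    _*ₑ_ : Expr → Expr → Expr
    _^ₑ_ : Expr → ℕ → Expr

  ⟦_⟧ : Expr → ℕ → ℕ
  ⟦ var ⟧    x = x
  ⟦ lit c ⟧  x = c
  ⟦ sucₑ e ⟧ x = suc (⟦ e ⟧ x)
  ⟦ e +ₑ f ⟧ x = ⟦ e ⟧ x ⊕ ⟦ f ⟧ x
  ⟦ e *ₑ f ⟧ x = ⟦ e ⟧ x ⊗ ⟦ f ⟧ x
  ⟦ e ^ₑ k ⟧ x = ⟦ e ⟧ x ^ k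

  normalise : Expr → Poly
  normalise var      = 0 ∷ 1 ∷ []
  normalise (lit c)  = c ∷ []
  normalise (sucₑ e) = (1 ∷ []) +ₚ normalise e
  normalise (e +ₑ f) = normalise e +ₚ normalise f
  normalise (e *ₑ f) = normalise e *ₚ normalise f
  normalise (e ^ₑ k) = normalise e ^ₚ k

  ⟦⟧≡eval-normalise : ∀ e x → ⟦ e ⟧ x ≡ eval (normalise e) x
  ⟦⟧≡eval-normalise var      x = sym (trans (cong (λ y → x * (1 + y)) (*-zeroʳ x)) (*-identityʳ x))
  ⟦⟧≡eval-normalise (lit c)  x = sym (trans (cong (c +_) (*-zeroʳ x)) (+-identityʳ c))
  ⟦⟧≡eval-normalise (sucₑ e) x = trans (cong suc (⟦⟧≡eval-normalise e x)) (sym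
    (trans (eval-+ₚ (1 ∷ []) (normalise e) x) (cong (λ c → 1 + c + eval (normalise e) x) (*-zeroʳ x))))
  ⟦⟧≡eval-normalise (e +ₑ f) x = trans (⊕-def _ _) (trans (cong₂ _+_ (⟦⟧≡eval-normalise e x) (⟦⟧≡eval-normalise f x))
                                                          (sym (eval-+ₚ (normalise e) (normalise f) x)))
  ⟦⟧≡eval-normalise (e *ₑ f) x = trans (⊗-def _ _) (trans (cong₂ _*_ (⟦⟧≡eval-normalise e x) (⟦⟧≡eval-normalise f x))
                                                          (sym (eval-*ₚ (normalise e) (normalise f) x)))
  ⟦⟧≡eval-normalise (e ^ₑ k) x = trans (cong (_^ k) (⟦⟧≡eval-normalise e x)) (sym (eval-^ₚ (normalise e) k x))

  ≤-by-normalisation : ∀ e f → T (normalise e ≤ᶜ normalise f) → ∀ x → ⟦ e ⟧ x ≤ ⟦ f ⟧ x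
  ≤-by-normalisation e f e≤f x = subst₂ _≤_ (sym (⟦⟧≡eval-normalise e x)) (sym (⟦⟧≡eval-normalise f x))
    (eval-mono-≤ᶜ (normalise e) (normalise f) e≤f x)

  ≡-by-normalisation : ∀ e f → T (normalise e ≤ᶜ normalise f ∧ normalise f ≤ᶜ normalise e) →
                       ∀ x → ⟦ e ⟧ x ≡ ⟦ f ⟧ x
  ≡-by-normalisation e f h x with Equivalence.to T-∧ h
  ... | e≤f , f≤e = ≤-antisym (≤-by-normalisation e f e≤f x) (≤-by-normalisation f e f≤e x)

  HasPositiveConstant : Expr → Set
  HasPositiveConstant e = T (1 ≤ᵇ constant (normalise e))

  nonZero-by-normalisation : ∀ e → HasPositiveConstant e → ∀ x → NonZero (⟦ e ⟧ x)
  nonZero-by-normalisation e h x = >-nonZero (begin-strict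
    0                      <⟨ ≤ᵇ⇒≤ 1 _ h ⟩
    constant (normalise e) ≤⟨ constant≤eval (normalise e) x ⟩
    eval (normalise e) x   ≡⟨ ⟦⟧≡eval-normalise e x ⟨
    ⟦ e ⟧ x                ∎)
    where open ≤-Reasoning

  infixr 9 _∘ₑ_

  _∘ₑ_ : Expr → Expr → Expr
  var      ∘ₑ g = g
  lit c    ∘ₑ g = lit c
  sucₑ e   ∘ₑ g = sucₑ (e ∘ₑ g)
  (e +ₑ f) ∘ₑ g = e ∘ₑ g +ₑ f ∘ₑ g
  (e *ₑ f) ∘ₑ g = e ∘ₑ g *ₑ f ∘ₑ g
  (e ^ₑ k) ∘ₑ g = e ∘ₑ g ^ₑ k

  ⟦∘ₑ⟧ : ∀ e g x → ⟦ e ∘ₑ g ⟧ x ≡ ⟦ e ⟧ (⟦ g ⟧ x)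
  ⟦∘ₑ⟧ var      g x = refl
  ⟦∘ₑ⟧ (lit c)  g x = refl
  ⟦∘ₑ⟧ (sucₑ e) g x = cong suc (⟦∘ₑ⟧ e g x)
  ⟦∘ₑ⟧ (e +ₑ f) g x = cong₂ _⊕_ (⟦∘ₑ⟧ e g x) (⟦∘ₑ⟧ f g x)
  ⟦∘ₑ⟧ (e *ₑ f) g x = cong₂ _⊗_ (⟦∘ₑ⟧ e g x) (⟦∘ₑ⟧ f g x)
  ⟦∘ₑ⟧ (e ^ₑ k) g x = cong (_^ k) (⟦∘ₑ⟧ e g x)

module Fractions where

  open import Data.Nat as ℕ using (suc)
  open import Data.Nat.Properties using (m*n≢0)
  open import Data.Integer as ℤ using (+_)
  open import Data.Integer.Properties using (pos-*; pos-+)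
  open import Data.Rational using (_/_; _+_; _*_; _≤_; toℚᵘ)
  open import Data.Rational.Properties
    using (toℚᵘ-injective; toℚᵘ-fromℚᵘ; toℚᵘ-homo-+; toℚᵘ-homo-*; toℚᵘ-cancel-≤)
  open import Data.Rational.Unnormalised as ℚᵘ using (mkℚᵘ; _≃_; *≡*; *≤*)
  open import Data.Rational.Unnormalised.Properties
    using (≃-sym; ≃-trans; ≃-reflexive; +-cong; *-cong; ≤-respˡ-≃; ≤-respʳ-≃)
  open import Relation.Binary.PropositionalEquality

  toℚᵘ-/ : ∀ i b .{{_ : NonZero b}} → toℚᵘ (i / b) ≃ (i ℚᵘ./ b)
  toℚᵘ-/ i (suc b) = toℚᵘ-fromℚᵘ (mkℚᵘ i b)

  /-cross-≡ : ∀ a b c d .{{_ : NonZero b}} .{{_ : NonZero d}} →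
              a ℕ.* d ≡ c ℕ.* b → + a / b ≡ + c / d
  /-cross-≡ a b@(suc _) c d@(suc _) ad≡cb = toℚᵘ-injective
    (≃-trans (toℚᵘ-/ (+ a) b) (≃-trans (*≡* cross) (≃-sym (toℚᵘ-/ (+ c) d))))
    where
    cross : + a ℤ.* + d ≡ + c ℤ.* + b
    cross = trans (sym (pos-* a d)) (trans (cong +_ ad≡cb) (pos-* c b))

  /-cross-≤ : ∀ a b c d .{{_ : NonZero b}} .{{_ : NonZero d}} →
              a ℕ.* d ℕ.≤ c ℕ.* b → + a / b ≤ + c / d
  /-cross-≤ a b@(suc _) c d@(suc _) ad≤cb = toℚᵘ-cancel-≤
    (≤-respˡ-≃ (≃-sym (toℚᵘ-/ (+ a) b)) (≤-respʳ-≃ (≃-sym (toℚᵘ-/ (+ c) d)) (*≤* cross)))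
    where
    cross : + a ℤ.* + d ℤ.≤ + c ℤ.* + b
    cross = subst₂ ℤ._≤_ (pos-* a d) (pos-* c b) (ℤ.+≤+ ad≤cb)

  /-+-/ : ∀ a b c d .{{_ : NonZero b}} .{{_ : NonZero d}} →
          + a / b + + c / d ≡ (+ (a ℕ.* d ℕ.+ c ℕ.* b) / (b ℕ.* d)) {{m*n≢0 b d}}
  /-+-/ a b@(suc _) c d@(suc _) = toℚᵘ-injective
    (≃-trans (toℚᵘ-homo-+ (+ a / b) (+ c / d))
    (≃-trans (+-cong (toℚᵘ-/ (+ a) b) (toℚᵘ-/ (+ c) d))
    (≃-trans (≃-reflexive (cong (λ i → mkℚᵘ i _) numerator))
             (≃-sym (toℚᵘ-/ (+ (a ℕ.* d ℕ.+ c ℕ.* b)) (b ℕ.* d) {{m*n≢0 b d}})))))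
    where
    numerator : + a ℤ.* + d ℤ.+ + c ℤ.* + b ≡ + (a ℕ.* d ℕ.+ c ℕ.* b)
    numerator = sym (trans (pos-+ (a ℕ.* d) (c ℕ.* b)) (cong₂ ℤ._+_ (pos-* a d) (pos-* c b)))

  /-*-/ : ∀ a b c d .{{_ : NonZero b}} .{{_ : NonZero d}} →
          + a / b * (+ c / d) ≡ (+ (a ℕ.* c) / (b ℕ.* d)) {{m*n≢0 b d}}
  /-*-/ a b@(suc _) c d@(suc _) = toℚᵘ-injective
    (≃-trans (toℚᵘ-homo-* (+ a / b) (+ c / d))
    (≃-trans (*-cong (toℚᵘ-/ (+ a) b) (toℚᵘ-/ (+ c) d))
    (≃-trans (≃-reflexive (cong (λ i → mkℚᵘ i _) (sym (pos-* a c))))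
             (≃-sym (toℚᵘ-/ (+ (a ℕ.* c)) (b ℕ.* d) {{m*n≢0 b d}})))))

module RationalFunctions where

  open import Data.Bool using (T; _∧_)
  open import Data.Nat as ℕ using (z≤n)
  open import Data.Nat.Properties using (m*n≢0)
  open import Data.Integer using (+_)
  open import Data.Rational using (ℚ; _/_; _+_; _*_; _≤_; 0ℚ)
  open import Data.Rational.Properties using (/-cong)
  open import Relation.Binary.PropositionalEquality
  open Polynomials
  open Fractions

  infixl 6 _⊞_
  infixl 7 _⊠_
  infix  5 _÷_
  infixr 9 _∘ᴿ_

  data RExpr : Set where
    frac : (p d : Expr) → (∀ x → NonZero (⟦ d ⟧ x)) → RExpr
    _⊞_  : RExpr → RExpr → RExpr
    _⊠_  : RExpr → RExpr → RExpr

  _÷_ : (p d : Expr) → {HasPositiveConstant d} → RExpr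
  (p ÷ d) {h} = frac p d (nonZero-by-normalisation d h)

  ⟦_⟧ᴿ : RExpr → ℕ → ℚ
  ⟦ frac p d d≢0 ⟧ᴿ x = (+ ⟦ p ⟧ x / ⟦ d ⟧ x) {{d≢0 x}}
  ⟦ q ⊞ r ⟧ᴿ        x = ⟦ q ⟧ᴿ x + ⟦ r ⟧ᴿ x
  ⟦ q ⊠ r ⟧ᴿ        x = ⟦ q ⟧ᴿ x * ⟦ r ⟧ᴿ x

  numer denom : RExpr → Expr
  numer (frac p d _) = p
  numer (q ⊞ r)      = numer q *ₑ denom r +ₑ numer r *ₑ denom q
  numer (q ⊠ r)      = numer q *ₑ numer r
  denom (frac p d _) = d
  denom (q ⊞ r)      = denom q *ₑ denom r
  denom (q ⊠ r)      = denom q *ₑ denom r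

  ⊗-nonZero : ∀ a b → .{{NonZero a}} → .{{NonZero b}} → NonZero (a ⊗ b)
  ⊗-nonZero a b = subst NonZero (sym (⊗-def a b)) (m*n≢0 a b)

  denom-nonZero : ∀ q x → NonZero (⟦ denom q ⟧ x)
  denom-nonZero (frac p d d≢0) x = d≢0 x
  denom-nonZero (q ⊞ r)        x = ⊗-nonZero _ _ {{denom-nonZero q x}} {{denom-nonZero r x}}
  denom-nonZero (q ⊠ r)        x = ⊗-nonZero _ _ {{denom-nonZero q x}} {{denom-nonZero r x}}

  ⟦⟧ᴿ≡numer/denom : ∀ q x → ⟦ q ⟧ᴿ x ≡ (+ ⟦ numer q ⟧ x / ⟦ denom q ⟧ x) {{denom-nonZero q x}}
  ⟦⟧ᴿ≡numer/denom (frac p d _) x = refl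
  ⟦⟧ᴿ≡numer/denom (q ⊞ r) x = begin
    ⟦ q ⟧ᴿ x + ⟦ r ⟧ᴿ x                              ≡⟨ cong₂ _+_ (⟦⟧ᴿ≡numer/denom q x) (⟦⟧ᴿ≡numer/denom r x) ⟩
    (+ a / b) {{b≢0}} + (+ c / d) {{d≢0}}            ≡⟨ /-+-/ a b c d {{b≢0}} {{d≢0}} ⟩
    (+ (a ℕ.* d ℕ.+ c ℕ.* b) / (b ℕ.* d)) {{bd≢0}}   ≡⟨ /-cong {{bd≢0}} {{denom-nonZero (q ⊞ r) x}}
                                                          (cong +_ (sym (trans (⊕-def _ _) (cong₂ ℕ._+_ (⊗-def a d) (⊗-def c b)))))
                                                          (sym (⊗-def b d)) ⟩
    (+ (a ⊗ d ⊕ c ⊗ b) / (b ⊗ d)) {{denom-nonZero (q ⊞ r) x}} ∎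
    where
    open ≡-Reasoning
    a = ⟦ numer q ⟧ x
    b = ⟦ denom q ⟧ x
    c = ⟦ numer r ⟧ x
    d = ⟦ denom r ⟧ x
    b≢0 = denom-nonZero q x
    d≢0 = denom-nonZero r x
    bd≢0 = m*n≢0 b d {{b≢0}} {{d≢0}}
  ⟦⟧ᴿ≡numer/denom (q ⊠ r) x = begin
    ⟦ q ⟧ᴿ x * ⟦ r ⟧ᴿ x                              ≡⟨ cong₂ _*_ (⟦⟧ᴿ≡numer/denom q x) (⟦⟧ᴿ≡numer/denom r x) ⟩
    (+ a / b) {{b≢0}} * (+ c / d) {{d≢0}}            ≡⟨ /-*-/ a b c d {{b≢0}} {{d≢0}} ⟩
    (+ (a ℕ.* c) / (b ℕ.* d)) {{bd≢0}}               ≡⟨ /-cong {{bd≢0}} {{denom-nonZero (q ⊠ r) x}}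
                                                          (cong +_ (sym (⊗-def a c))) (sym (⊗-def b d)) ⟩
    (+ (a ⊗ c) / (b ⊗ d)) {{denom-nonZero (q ⊠ r) x}} ∎
    where
    open ≡-Reasoning
    a = ⟦ numer q ⟧ x
    b = ⟦ denom q ⟧ x
    c = ⟦ numer r ⟧ x
    d = ⟦ denom r ⟧ x
    b≢0 = denom-nonZero q x
    d≢0 = denom-nonZero r x
    bd≢0 = m*n≢0 b d {{b≢0}} {{d≢0}}

  0≤⟦⟧ᴿ : ∀ q x → 0ℚ ≤ ⟦ q ⟧ᴿ x
  0≤⟦⟧ᴿ q x = subst (0ℚ ≤_) (sym (⟦⟧ᴿ≡numer/denom q x))
    (/-cross-≤ 0 1 (⟦ numer q ⟧ x) (⟦ denom q ⟧ x) {{_}} {{denom-nonZero q x}} z≤n)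

  ≤ᴿ-by-normalisation : ∀ q r → T (normalise (numer q *ₑ denom r) ≤ᶜ normalise (numer r *ₑ denom q)) →
                        ∀ x → ⟦ q ⟧ᴿ x ≤ ⟦ r ⟧ᴿ x
  ≤ᴿ-by-normalisation q r h x = subst₂ _≤_ (sym (⟦⟧ᴿ≡numer/denom q x)) (sym (⟦⟧ᴿ≡numer/denom r x))
    (/-cross-≤ a b c d {{denom-nonZero q x}} {{denom-nonZero r x}}
      (subst₂ ℕ._≤_ (⊗-def a d) (⊗-def c b) (≤-by-normalisation (numer q *ₑ denom r) (numer r *ₑ denom q) h x)))
    where
    a = ⟦ numer q ⟧ x
    b = ⟦ denom q ⟧ x
    c = ⟦ numer r ⟧ x
    d = ⟦ denom r ⟧ x

  ≡ᴿ-by-normalisation : ∀ q r →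
    T (normalise (numer q *ₑ denom r) ≤ᶜ normalise (numer r *ₑ denom q) ∧
       normalise (numer r *ₑ denom q) ≤ᶜ normalise (numer q *ₑ denom r)) →
    ∀ x → ⟦ q ⟧ᴿ x ≡ ⟦ r ⟧ᴿ x
  ≡ᴿ-by-normalisation q r h x = trans (⟦⟧ᴿ≡numer/denom q x) (trans
    (/-cross-≡ a b c d {{denom-nonZero q x}} {{denom-nonZero r x}}
      (trans (sym (⊗-def a d)) (trans (≡-by-normalisation (numer q *ₑ denom r) (numer r *ₑ denom q) h x) (⊗-def c b))))
    (sym (⟦⟧ᴿ≡numer/denom r x)))
    where
    a = ⟦ numer q ⟧ x
    b = ⟦ denom q ⟧ x
    c = ⟦ numer r ⟧ x
    d = ⟦ denom r ⟧ x

  _∘ᴿ_ : RExpr → Expr → RExpr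
  frac p d d≢0 ∘ᴿ g = frac (p ∘ₑ g) (d ∘ₑ g) (λ x → subst NonZero (sym (⟦∘ₑ⟧ d g x)) (d≢0 (⟦ g ⟧ x)))
  (q ⊞ r)      ∘ᴿ g = q ∘ᴿ g ⊞ r ∘ᴿ g
  (q ⊠ r)      ∘ᴿ g = q ∘ᴿ g ⊠ r ∘ᴿ g

  ⟦∘ᴿ⟧ : ∀ q g x → ⟦ q ∘ᴿ g ⟧ᴿ x ≡ ⟦ q ⟧ᴿ (⟦ g ⟧ x)
  ⟦∘ᴿ⟧ (frac p d d≢0) g x = /-cong {{subst NonZero (sym (⟦∘ₑ⟧ d g x)) (d≢0 (⟦ g ⟧ x))}} {{d≢0 (⟦ g ⟧ x)}}
                                   (cong +_ (⟦∘ₑ⟧ p g x)) (⟦∘ₑ⟧ d g x)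
  ⟦∘ᴿ⟧ (q ⊞ r)        g x = cong₂ _+_ (⟦∘ᴿ⟧ q g x) (⟦∘ᴿ⟧ r g x)
  ⟦∘ᴿ⟧ (q ⊠ r)        g x = cong₂ _*_ (⟦∘ᴿ⟧ q g x) (⟦∘ᴿ⟧ r g x)

module AlternatingTails where

  open import Data.Nat as ℕ using (zero; suc)
  open import Data.Nat.Properties using (m^n≢0)
  open import Data.Integer using (+_)
  open import Data.Rational using (ℚ; _/_; _+_; _*_; _-_; -_; _≤_; 0ℚ; 1ℚ; ½; nonNegative)
  open import Data.Rational.Properties
    using (≤-refl; ≤-trans; ≤ᵇ⇒≤; +-monoʳ-≤; +-monoˡ-≤; neg-antimono-≤; *-monoˡ-≤-nonNeg; *-monoʳ-≤-nonNeg;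
           *-zeroʳ; *-identityʳ; +-comm; neg-distribˡ-*; module ≤-Reasoning)
  open import Data.Rational.Solver using (module +-*-Solver)
  open +-*-Solver using (solve; _:+_; _:*_; _:-_; :-_; con; _:=_)
  open import Data.Product using (_×_; _,_; proj₁; proj₂)
  open import Relation.Binary.PropositionalEquality
  open Fractions

  ½^_ : ℕ → ℚ
  ½^ m = (+ 1 / 2 ℕ.^ m) {{m^n≢0 2 m}}

  ½^-suc : ∀ m → ½^ suc m ≡ ½ * ½^ m
  ½^-suc m = sym (/-*-/ 1 2 1 (2 ℕ.^ m) {{_}} {{m^n≢0 2 m}})

  0≤½^ : ∀ m → 0ℚ ≤ ½^ m
  0≤½^ m = /-cross-≤ 0 1 1 (2 ℕ.^ m) {{_}} {{m^n≢0 2 m}} ℕ.z≤n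

  *-monoˡ-≤-0≤ : ∀ {r x y} → 0ℚ ≤ r → x ≤ y → r * x ≤ r * y
  *-monoˡ-≤-0≤ {r} 0≤r = *-monoˡ-≤-nonNeg r {{nonNegative 0≤r}}

  *-monoʳ-≤-0≤ : ∀ {r x y} → 0ℚ ≤ r → x ≤ y → x * r ≤ y * r
  *-monoʳ-≤-0≤ {r} 0≤r = *-monoʳ-≤-nonNeg r {{nonNegative 0≤r}}

  minus-antimonoʳ-≤ : ∀ c {x y} → x ≤ y → c - y ≤ c - x
  minus-antimonoʳ-≤ c x≤y = +-monoʳ-≤ c (neg-antimono-≤ x≤y)

  p≤q+r⇒p-r≤q : ∀ {p q r} → p ≤ q + r → p - r ≤ q
  p≤q+r⇒p-r≤q {p} {q} {r} p≤q+r = subst (p - r ≤_) (cancel q r) (+-monoˡ-≤ (- r) p≤q+r)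
    where
    cancel : ∀ q r → q + r - r ≡ q
    cancel = solve 2 (λ q r → q :+ r :- r := q) refl

  p+r≤q⇒p≤q-r : ∀ {p q r} → p + r ≤ q → p ≤ q - r
  p+r≤q⇒p≤q-r {p} {q} {r} p+r≤q = subst (_≤ q - r) (cancel p r) (+-monoˡ-≤ (- r) p+r≤q)
    where
    cancel : ∀ p r → p + r - r ≡ p
    cancel = solve 2 (λ p r → p :+ r :- r := p) refl

  deviation-below : ∀ {ℓ b v k} → 0ℚ ≤ k → ℓ - b ≤ v → - (b * k) ≤ (v - ℓ) * k
  deviation-below {ℓ} {b} {v} {k} 0≤k ℓ-b≤v = subst (_≤ (v - ℓ) * k) (sym (neg-distribˡ-* b k))
    (*-monoʳ-≤-0≤ 0≤k (subst (_≤ v - ℓ) (cancel ℓ b) (+-monoˡ-≤ (- ℓ) ℓ-b≤v)))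
    where
    cancel : ∀ ℓ b → ℓ - b - ℓ ≡ - b
    cancel = solve 2 (λ ℓ b → ℓ :- b :- ℓ := :- b) refl

  deviation-above : ∀ {u b v k} → 0ℚ ≤ k → v ≤ u + b → (v - u) * k ≤ b * k
  deviation-above {u} {b} {v} 0≤k v≤u+b =
    *-monoʳ-≤-0≤ 0≤k (p≤q+r⇒p-r≤q {v} {b} {u} (subst (v ≤_) (+-comm u b) v≤u+b))

  -- The tail Σ_{k≥n} (-1)^k s_k divided by (-1)^n s_n and truncated after m + 1 terms,
  -- when r n = s (n + 1) / s n.
  normalisedTail : (ℕ → ℚ) → ℕ → ℕ → ℚ
  normalisedTail r n zero    = 1ℚ
  normalisedTail r n (suc m) = 1ℚ - r n * normalisedTail r (suc n) m

  module _ (r : ℕ → ℚ) (0≤r : ∀ n → 0ℚ ≤ r n) (r≤½ : ∀ n → r n ≤ ½) where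

    normalisedTail-bounded : ∀ n m → 0ℚ ≤ normalisedTail r n m × normalisedTail r n m ≤ 1ℚ
    normalisedTail-bounded n zero    = ≤ᵇ⇒≤ _ , ≤-refl
    normalisedTail-bounded n (suc m) = minus-antimonoʳ-≤ 1ℚ rw≤1 , minus-antimonoʳ-≤ 1ℚ 0≤rw
      where
      w = normalisedTail r (suc n) m
      0≤rw : 0ℚ ≤ r n * w
      0≤rw = subst (_≤ r n * w) (*-zeroʳ (r n)) (*-monoˡ-≤-0≤ (0≤r n) (proj₁ (normalisedTail-bounded (suc n) m)))
      rw≤1 : r n * w ≤ 1ℚ
      rw≤1 = ≤-trans (*-monoˡ-≤-0≤ (0≤r n) (proj₂ (normalisedTail-bounded (suc n) m)))
                     (subst (_≤ 1ℚ) (sym (*-identityʳ (r n))) (≤-trans (r≤½ n) (≤ᵇ⇒≤ _)))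

    -- The hypotheses say that v ↦ 1 - r n v maps [L (n + 1), U (n + 1)] into [L n, U n].
    module _ (L U : ℕ → ℚ) (L≤1 : ∀ n → L n ≤ 1ℚ) (0≤U : ∀ n → 0ℚ ≤ U n)
             (1≤U+rL : ∀ n → 1ℚ ≤ U n + r n * L (suc n))
             (L+rU≤1 : ∀ n → L n + r n * U (suc n) ≤ 1ℚ) where

      normalisedTail-between : ∀ n m → L n - ½^ m ≤ normalisedTail r n m × normalisedTail r n m ≤ U n + ½^ m
      normalisedTail-between n zero    = ≤-trans (+-monoˡ-≤ (- 1ℚ) (L≤1 n)) (≤ᵇ⇒≤ _) , +-monoˡ-≤ 1ℚ (0≤U n)
      normalisedTail-between n (suc m) = lower , upper
        where
        open ≤-Reasoning
        w  = normalisedTail r (suc n) m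
        B  = ½^ m
        L′ = L (suc n)
        U′ = U (suc n)
        ih = normalisedTail-between (suc n) m
        rB≤½B : r n * B ≤ ½ * B
        rB≤½B = *-monoʳ-≤-0≤ (0≤½^ m) (r≤½ n)
        expand : ∀ r x b → 1ℚ - r * (x - b) ≡ 1ℚ - r * x + r * b
        expand = solve 3 (λ r x b → con 1ℚ :- r :* (x :- b) := con 1ℚ :- r :* x :+ r :* b) refl
        collect : ∀ r x b → 1ℚ - r * x - r * b ≡ 1ℚ - r * (x + b)
        collect = solve 3 (λ r x b → con 1ℚ :- r :* x :- r :* b := con 1ℚ :- r :* (x :+ b)) refl
        upper : 1ℚ - r n * w ≤ U n + ½^ suc m
        upper = begin
          1ℚ - r n * w              ≤⟨ minus-antimonoʳ-≤ 1ℚ (*-monoˡ-≤-0≤ (0≤r n) (proj₁ ih)) ⟩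
          1ℚ - r n * (L′ - B)       ≡⟨ expand (r n) L′ B ⟩
          1ℚ - r n * L′ + r n * B   ≤⟨ +-monoˡ-≤ (r n * B) (p≤q+r⇒p-r≤q {1ℚ} {U n} {r n * L′} (1≤U+rL n)) ⟩
          U n + r n * B             ≤⟨ +-monoʳ-≤ (U n) rB≤½B ⟩
          U n + ½ * B               ≡⟨ cong (λ b → U n + b) (½^-suc m) ⟨
          U n + ½^ suc m            ∎
        lower : L n - ½^ suc m ≤ 1ℚ - r n * w
        lower = begin
          L n - ½^ suc m            ≡⟨ cong (λ b → L n - b) (½^-suc m) ⟩
          L n - ½ * B               ≤⟨ minus-antimonoʳ-≤ (L n) rB≤½B ⟩
          L n - r n * B             ≤⟨ +-monoˡ-≤ (- (r n * B)) (p+r≤q⇒p≤q-r {L n} {1ℚ} {r n * U′} (L+rU≤1 n)) ⟩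
          1ℚ - r n * U′ - r n * B   ≡⟨ collect (r n) U′ B ⟩
          1ℚ - r n * (U′ + B)       ≤⟨ minus-antimonoʳ-≤ 1ℚ (*-monoˡ-≤-0≤ (0≤r n) (proj₂ ih)) ⟩
          1ℚ - r n * w              ∎

module ChudnovskyRatio where

  open import Data.Nat using (zero; suc; _+_; _*_; _^_; _!)
  open import Data.Nat.Properties
    using (*-suc; *-assoc; *-identityˡ; ^-distribˡ-+-*; m*n≢0; +-*-commutativeSemiring)
  open import Data.Nat.Tactic.RingSolver using (solve-∀)
  open import Algebra.Properties.CommutativeSemiring.Exp +-*-commutativeSemiring using (^-distrib-*)
  open import Data.Integer using (+_)
  open import Data.Rational as ℚ using (ℚ; _/_; _≤_; 0ℚ; ½)
  open import Relation.Binary.PropositionalEquality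
  open Polynomials
  open Fractions
  open RationalFunctions

  rising : ℕ → ℕ → ℕ
  rising zero    n = 1
  rising (suc j) n = (suc j + n) * rising j n

  !≡rising*! : ∀ j n → (j + n) ! ≡ rising j n * n !
  !≡rising*! zero    n = sym (*-identityˡ (n !))
  !≡rising*! (suc j) n = trans (cong ((suc j + n) *_) (!≡rising*! j n)) (sym (*-assoc (suc j + n) (rising j n) (n !)))

  risingₑ : ℕ → Expr → Expr
  risingₑ zero    e = lit 1
  risingₑ (suc j) e = (lit (suc j) +ₑ e) *ₑ risingₑ j e

  ⟦risingₑ⟧ : ∀ j e x → ⟦ risingₑ j e ⟧ x ≡ rising j (⟦ e ⟧ x)
  ⟦risingₑ⟧ zero    e x = refl
  ⟦risingₑ⟧ (suc j) e x = trans (⊗-def _ _) (cong₂ _*_ (⊕-def (suc j) (⟦ e ⟧ x)) (⟦risingₑ⟧ j e x))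

  var+1 : Expr
  var+1 = sucₑ var

  linearFactor : Expr
  linearFactor = lit 545140134 *ₑ var +ₑ lit 13591409

  ⟦linearFactor⟧ : ∀ x → ⟦ linearFactor ⟧ x ≡ 545140134 * x + 13591409
  ⟦linearFactor⟧ x = trans (⊕-def _ 13591409) (cong (_+ 13591409) (⊗-def 545140134 x))

  -- s_{k+1} / s_k, using (6k+1)⋯(6k+6) = 8 (6k+1)(6k+3)(6k+5) (3k+1)(3k+2)(3k+3).
  ratioNumerator ratioDenominator : Expr
  ratioNumerator = lit 8 *ₑ (lit 6 *ₑ var +ₑ lit 1) *ₑ (lit 6 *ₑ var +ₑ lit 3) *ₑ (lit 6 *ₑ var +ₑ lit 5)
                   *ₑ linearFactor ∘ₑ var+1
  ratioDenominator = var+1 ^ₑ 3 *ₑ lit (640320 ^ 3) *ₑ linearFactor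

  s-ratio : RExpr
  s-ratio = ratioNumerator ÷ ratioDenominator

  ratio-identity : ∀ k →
    rising 6 (6 * k) * (545140134 * suc k + 13591409) * ⟦ ratioDenominator ⟧ k ≡
    ⟦ ratioNumerator ⟧ k * (545140134 * k + 13591409) * rising 3 (3 * k) * suc k ^ 3 * 640320 ^ 3
  ratio-identity k = begin
    rising 6 (6 * k) * (545140134 * suc k + 13591409) * Q
      ≡⟨ cong (λ l → rising 6 (6 * k) * l * Q) (sym (trans (⟦∘ₑ⟧ linearFactor var+1 k) (⟦linearFactor⟧ (suc k)))) ⟩
    rising 6 (6 * k) * ⟦ linearFactor ∘ₑ var+1 ⟧ k * Q
      ≡⟨ cong (λ p → p * ⟦ linearFactor ∘ₑ var+1 ⟧ k * Q)
              (sym (trans (⟦risingₑ⟧ 6 (lit 6 *ₑ var) k) (cong (rising 6) (⊗-def 6 k)))) ⟩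
    ⟦ risingₑ 6 (lit 6 *ₑ var) ⟧ k * ⟦ linearFactor ∘ₑ var+1 ⟧ k * Q
      ≡⟨ sym (trans (⊗-def _ Q) (cong (_* Q) (⊗-def _ _))) ⟩
    ⟦ risingₑ 6 (lit 6 *ₑ var) *ₑ linearFactor ∘ₑ var+1 *ₑ ratioDenominator ⟧ k
      ≡⟨ ≡-by-normalisation (risingₑ 6 (lit 6 *ₑ var) *ₑ linearFactor ∘ₑ var+1 *ₑ ratioDenominator)
                            (ratioNumerator *ₑ linearFactor *ₑ risingₑ 3 (lit 3 *ₑ var) *ₑ var+1 ^ₑ 3 *ₑ lit (640320 ^ 3)) _ k ⟩
    ⟦ ratioNumerator *ₑ linearFactor *ₑ risingₑ 3 (lit 3 *ₑ var) *ₑ var+1 ^ₑ 3 *ₑ lit (640320 ^ 3) ⟧ k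
      ≡⟨ trans (⊗-def _ _) (cong (_* 640320 ^ 3) (trans (⊗-def _ _) (cong (_* suc k ^ 3) (trans (⊗-def _ _)
           (cong₂ _*_ (⊗-def _ _) (⟦risingₑ⟧ 3 (lit 3 *ₑ var) k)))))) ⟩
    R * ⟦ linearFactor ⟧ k * rising 3 (⟦ lit 3 *ₑ var ⟧ k) * suc k ^ 3 * 640320 ^ 3
      ≡⟨ cong₂ (λ l m → R * l * rising 3 m * suc k ^ 3 * 640320 ^ 3) (⟦linearFactor⟧ k) (⊗-def 3 k) ⟩
    R * (545140134 * k + 13591409) * rising 3 (3 * k) * suc k ^ 3 * 640320 ^ 3 ∎
    where
    open ≡-Reasoning
    R = ⟦ ratioNumerator ⟧ k
    Q = ⟦ ratioDenominator ⟧ k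

  -- Separate equations: comparing sNum k or sDen k with its unfolding inside a larger
  -- product makes the type checker unfold the literal multiplications.
  sNum-unfold : ∀ k → (6 * k) ! * (545140134 * k + 13591409) ≡ sNum k
  sNum-unfold k = refl

  sDen-unfold : ∀ k → (3 * k) ! * (k !) ^ 3 * 640320 ^ (3 * k) * 545140134 ≡ sDen k
  sDen-unfold k = refl

  sNum-suc : ∀ k → sNum (suc k) ≡ rising 6 (6 * k) * (6 * k) ! * (545140134 * suc k + 13591409)
  sNum-suc k = cong (_* (545140134 * suc k + 13591409)) (trans (cong _! (*-suc 6 k)) (!≡rising*! 6 (6 * k)))

  sDen-suc : ∀ k → sDen (suc k) ≡ rising 3 (3 * k) * suc k ^ 3 * 640320 ^ 3 * sDen k
  sDen-suc k = begin
    sDen (suc k)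
      ≡⟨ cong₂ (λ f p → f * (suc k !) ^ 3 * p * 545140134)
               (trans (cong _! (*-suc 3 k)) (!≡rising*! 3 (3 * k)))
               (trans (cong (640320 ^_) (*-suc 3 k)) (^-distribˡ-+-* 640320 3 (3 * k))) ⟩
    rising 3 (3 * k) * (3 * k) ! * (suc k !) ^ 3 * (640320 ^ 3 * 640320 ^ (3 * k)) * 545140134
      ≡⟨ cong (λ c → rising 3 (3 * k) * (3 * k) ! * c * (640320 ^ 3 * 640320 ^ (3 * k)) * 545140134)
              (^-distrib-* (suc k) (k !) 3) ⟩
    rising 3 (3 * k) * (3 * k) ! * (suc k ^ 3 * (k !) ^ 3) * (640320 ^ 3 * 640320 ^ (3 * k)) * 545140134
      ≡⟨ regroup (rising 3 (3 * k)) ((3 * k) !) (suc k ^ 3) ((k !) ^ 3) (640320 ^ 3) (640320 ^ (3 * k)) 545140134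
                 (sDen k) (sDen-unfold k) ⟩
    rising 3 (3 * k) * suc k ^ 3 * 640320 ^ 3 * sDen k ∎
    where
    open ≡-Reasoning
    regroup : ∀ p G n³ h³ K D c d → G * h³ * D * c ≡ d → p * G * (n³ * h³) * (K * D) * c ≡ p * n³ * K * d
    regroup p G n³ h³ K D c _ refl = regroup′ p G n³ h³ K D c
      where
      regroup′ : ∀ p G n³ h³ K D c → p * G * (n³ * h³) * (K * D) * c ≡ p * n³ * K * (G * h³ * D * c)
      regroup′ = solve-∀

  cancel-common-factors : ∀ p₆ F l₁ Q d R l n p₃ n³ K → p₆ * l₁ * Q ≡ R * l * p₃ * n³ * K → F * l ≡ n →
                          p₆ * F * l₁ * (Q * d) ≡ R * n * (p₃ * n³ * K * d)
  cancel-common-factors p₆ F l₁ Q d R l _ p₃ n³ K eq refl = begin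
    p₆ * F * l₁ * (Q * d)           ≡⟨ left p₆ F l₁ Q d ⟩
    p₆ * l₁ * Q * (F * d)           ≡⟨ cong (_* (F * d)) eq ⟩
    R * l * p₃ * n³ * K * (F * d)   ≡⟨ right R l p₃ n³ K F d ⟩
    R * (F * l) * (p₃ * n³ * K * d) ∎
    where
    open ≡-Reasoning
    left : ∀ p₆ F l₁ Q d → p₆ * F * l₁ * (Q * d) ≡ p₆ * l₁ * Q * (F * d)
    left = solve-∀
    right : ∀ R l p₃ n³ K F d → R * l * p₃ * n³ * K * (F * d) ≡ R * (F * l) * (p₃ * n³ * K * d)
    right = solve-∀

  s-suc : ∀ k → s (suc k) ≡ ⟦ s-ratio ⟧ᴿ k ℚ.* s k
  s-suc k = begin
    s (suc k)                                ≡⟨ /-cross-≡ (sNum (suc k)) (sDen (suc k)) (R * sNum k) (Q * sDen k)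
                                                  {{sDen≢0 (suc k)}} {{QD≢0}} cross ⟩
    (+ (R * sNum k) / (Q * sDen k)) {{QD≢0}} ≡⟨ /-*-/ R Q (sNum k) (sDen k) {{Q≢0}} {{sDen≢0 k}} ⟨
    ⟦ s-ratio ⟧ᴿ k ℚ.* s k                   ∎
    where
    open ≡-Reasoning
    R = ⟦ ratioNumerator ⟧ k
    Q = ⟦ ratioDenominator ⟧ k
    Q≢0 : NonZero Q
    Q≢0 = nonZero-by-normalisation ratioDenominator _ k
    QD≢0 : NonZero (Q * sDen k)
    QD≢0 = m*n≢0 Q (sDen k) {{Q≢0}} {{sDen≢0 k}}
    cross : sNum (suc k) * (Q * sDen k) ≡ R * sNum k * sDen (suc k)
    cross = begin
      sNum (suc k) * (Q * sDen k)
        ≡⟨ cong (_* (Q * sDen k)) (sNum-suc k) ⟩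
      rising 6 (6 * k) * (6 * k) ! * (545140134 * suc k + 13591409) * (Q * sDen k)
        ≡⟨ cancel-common-factors (rising 6 (6 * k)) ((6 * k) !) (545140134 * suc k + 13591409) Q (sDen k)
             R (545140134 * k + 13591409) (sNum k) (rising 3 (3 * k)) (suc k ^ 3) (640320 ^ 3)
             (ratio-identity k) (sNum-unfold k) ⟩
      R * sNum k * (rising 3 (3 * k) * suc k ^ 3 * 640320 ^ 3 * sDen k)
        ≡⟨ cong (R * sNum k *_) (sDen-suc k) ⟨
      R * sNum k * sDen (suc k) ∎

  ratio : ℕ → ℚ
  ratio t = ⟦ s-ratio ⟧ᴿ (suc t)

  0≤ratio : ∀ t → 0ℚ ≤ ratio t
  0≤ratio t = 0≤⟦⟧ᴿ s-ratio (suc t)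

  ratio≤½ : ∀ t → ratio t ≤ ½
  ratio≤½ t = subst (_≤ ½) (⟦∘ᴿ⟧ s-ratio var+1 t) (≤ᴿ-by-normalisation (s-ratio ∘ᴿ var+1) (lit 1 ÷ lit 2) _ t)

module ChudnovskyTail where

  open import Data.Nat as ℕ using (zero; suc; _^_)
  open import Data.Nat.Properties using (+-suc; +-identityʳ; m^n≢0; m*n≢0)
  open import Data.Nat.Tactic.RingSolver using (solve-∀)
  open import Data.Integer using (+_)
  open import Data.Rational using (ℚ; _/_; _+_; _*_; _-_; -_; ∣_∣; _≤_; 0ℚ; 1ℚ)
  open import Data.Rational.Properties
    using (+-assoc; *-assoc; *-identityˡ; *-identityʳ; *-zeroʳ; ∣-p∣≡∣p∣; ∣p*q∣≡∣p∣*∣q∣; 0≤p⇒∣p∣≡p)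
  open import Data.Rational.Solver using (module +-*-Solver)
  open +-*-Solver using (solve; _:+_; _:*_; _:-_; :-_; con; _:=_)
  open import Data.Product using (proj₁)
  open import Relation.Binary.PropositionalEquality
  open Fractions
  open AlternatingTails
  open ChudnovskyRatio

  partialTail-split : ∀ n m → partialTail n (suc m) ≡ sgn n * s n + partialTail (suc n) m
  partialTail-split n zero    = cong (λ j → sgn n * s n + sgn j * s j) (trans (+-suc n 0) (cong suc (+-identityʳ n)))
  partialTail-split n (suc m) = begin
    partialTail n (suc m) + sgn (n ℕ.+ suc (suc m)) * s (n ℕ.+ suc (suc m))
      ≡⟨ cong₂ (λ p j → p + sgn j * s j) (partialTail-split n m) (+-suc n (suc m)) ⟩
    sgn n * s n + partialTail (suc n) m + sgn (suc n ℕ.+ suc m) * s (suc n ℕ.+ suc m)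
      ≡⟨ +-assoc (sgn n * s n) (partialTail (suc n) m) _ ⟩
    sgn n * s n + partialTail (suc n) (suc m) ∎
    where open ≡-Reasoning

  partialTail≡normalisedTail : ∀ t m → partialTail (suc t) m ≡ sgn (suc t) * s (suc t) * normalisedTail ratio t m
  partialTail≡normalisedTail t zero    = sym (*-identityʳ (sgn (suc t) * s (suc t)))
  partialTail≡normalisedTail t (suc m) = begin
    partialTail (suc t) (suc m)
      ≡⟨ partialTail-split (suc t) m ⟩
    g * s (suc t) + partialTail (suc (suc t)) m
      ≡⟨ cong (λ x → g * s (suc t) + x) (partialTail≡normalisedTail (suc t) m) ⟩
    g * s (suc t) + - g * s (suc (suc t)) * normalisedTail ratio (suc t) m
      ≡⟨ cong (λ x → g * s (suc t) + - g * x * normalisedTail ratio (suc t) m) (s-suc (suc t)) ⟩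
    g * s (suc t) + - g * (ratio t * s (suc t)) * normalisedTail ratio (suc t) m
      ≡⟨ factor g (s (suc t)) (ratio t) (normalisedTail ratio (suc t) m) ⟩
    g * s (suc t) * normalisedTail ratio t (suc m) ∎
    where
    open ≡-Reasoning
    g = sgn (suc t)
    factor : ∀ g x r v → g * x + - g * (r * x) * v ≡ g * x * (1ℚ - r * v)
    factor = solve 4 (λ g x r v → g :* x :+ (:- g) :* (r :* x) :* v := g :* x :* (con 1ℚ :- r :* v)) refl

  ∣sgn∣ : ∀ j → ∣ sgn j ∣ ≡ 1ℚ
  ∣sgn∣ zero    = refl
  ∣sgn∣ (suc j) = trans (∣-p∣≡∣p∣ (sgn j)) (∣sgn∣ j)

  0≤s : ∀ k → 0ℚ ≤ s k
  0≤s k = /-cross-≤ 0 1 (sNum k) (sDen k) {{_}} {{sDen≢0 k}} ℕ.z≤n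

  s*sInv : ∀ k → s k * sInv k ≡ 1ℚ
  s*sInv k = trans (/-*-/ (sNum k) (sDen k) (sDen k) (sNum k) {{sDen≢0 k}} {{sNum≢0 k}})
    (/-cross-≡ (sNum k ℕ.* sDen k) (sDen k ℕ.* sNum k) 1 1 {{m*n≢0 (sDen k) (sNum k) {{sDen≢0 k}} {{sNum≢0 k}}}} {{_}}
      (swap (sNum k) (sDen k)))
    where
    swap : ∀ a b → a ℕ.* b ℕ.* 1 ≡ 1 ℕ.* (b ℕ.* a)
    swap = solve-∀

  ∣partialTail∣ : ∀ t m → ∣ partialTail (suc t) m ∣ ≡ s (suc t) * normalisedTail ratio t m
  ∣partialTail∣ t m = begin
    ∣ partialTail (suc t) m ∣           ≡⟨ cong ∣_∣ (trans (partialTail≡normalisedTail t m) (*-assoc (sgn (suc t)) _ _)) ⟩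
    ∣ sgn (suc t) * (s (suc t) * v) ∣   ≡⟨ ∣p*q∣≡∣p∣*∣q∣ (sgn (suc t)) _ ⟩
    ∣ sgn (suc t) ∣ * ∣ s (suc t) * v ∣ ≡⟨ cong₂ _*_ (∣sgn∣ (suc t)) (0≤p⇒∣p∣≡p 0≤sv) ⟩
    1ℚ * (s (suc t) * v)                ≡⟨ *-identityˡ _ ⟩
    s (suc t) * v                       ∎
    where
    open ≡-Reasoning
    v = normalisedTail ratio t m
    0≤sv : 0ℚ ≤ s (suc t) * v
    0≤sv = subst (_≤ s (suc t) * v) (*-zeroʳ (s (suc t)))
             (*-monoˡ-≤-0≤ (0≤s (suc t)) (proj₁ (normalisedTail-bounded ratio 0≤ratio ratio≤½ t m)))

  -- e_{t+1} as a function of y = |tail| (1 + ε) / s_{t+1}.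
  e : ℕ → ℚ → ℚ
  e t y = (y - 1ℚ - a₁ * (+ 1 / suc t) - a₂ * (+ 1 / suc t ^ 2) {{m^n≢0 (suc t) 2}}) * (+ (suc t ^ 3) / 1) * εInv

  eApprox≡e : ∀ t m → eApprox (suc t) m ≡ e t (normalisedTail ratio t m * (1ℚ + ε))
  eApprox≡e t m = cong (e t) (begin
    ∣ partialTail (suc t) m ∣ * (1ℚ + ε) * sInv (suc t) ≡⟨ cong (λ a → a * (1ℚ + ε) * sInv (suc t)) (∣partialTail∣ t m) ⟩
    s (suc t) * v * (1ℚ + ε) * sInv (suc t)           ≡⟨ regroup (s (suc t)) v (1ℚ + ε) (sInv (suc t)) ⟩
    v * (1ℚ + ε) * (s (suc t) * sInv (suc t))         ≡⟨ cong (λ x → v * (1ℚ + ε) * x) (s*sInv (suc t)) ⟩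
    v * (1ℚ + ε) * 1ℚ                                 ≡⟨ *-identityʳ _ ⟩
    v * (1ℚ + ε)                                      ∎)
    where
    open ≡-Reasoning
    v = normalisedTail ratio t m
    regroup : ∀ x v k y → x * v * k * y ≡ v * k * (x * y)
    regroup = solve 4 (λ x v k y → x :* v :* k :* y := v :* k :* (x :* y)) refl

  κ : ℕ → ℚ
  κ t = (1ℚ + ε) * (+ (suc t ^ 3) / 1) * εInv

  e-affine : ∀ t x ℓ → e t (x * (1ℚ + ε)) ≡ e t (ℓ * (1ℚ + ε)) + (x - ℓ) * κ t
  e-affine t x ℓ =
    affine x ℓ (1ℚ + ε) 1ℚ (a₁ * (+ 1 / suc t)) (a₂ * (+ 1 / suc t ^ 2) {{m^n≢0 (suc t) 2}}) (+ (suc t ^ 3) / 1) εInv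
    where
    affine : ∀ x ℓ k o p q n i → (x * k - o - p - q) * n * i ≡ (ℓ * k - o - p - q) * n * i + (x - ℓ) * (k * n * i)
    affine = solve 8 (λ x ℓ k o p q n i →
      (x :* k :- o :- p :- q) :* n :* i := (ℓ :* k :- o :- p :- q) :* n :* i :+ (x :- ℓ) :* (k :* n :* i)) refl

  minus-a₂ : ℚ
  minus-a₂ = - a₂

  -- ℓ t is the value of the normalised tail at which e_{t+1} equals c.
  IsLevel : (ℕ → ℚ) → ℚ → Set
  IsLevel ℓ c = ∀ t → ℓ t * (1ℚ + ε) + minus-a₂ * (+ 1 / suc t ^ 2) {{m^n≢0 (suc t) 2}} ≡
                      1ℚ + a₁ * (+ 1 / suc t) + c * ε * (+ 1 / suc t ^ 3) {{m^n≢0 (suc t) 3}}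

  e-at-level : ∀ ℓ c → IsLevel ℓ c → ∀ t → e t (ℓ t * (1ℚ + ε)) ≡ c
  e-at-level ℓ c level t = begin
    (ℓ t * (1ℚ + ε) - 1ℚ - a₁ * X₁ - a₂ * X₂) * N₃ * εInv
      ≡⟨ move (ℓ t * (1ℚ + ε)) minus-a₂ X₂ (a₁ * X₁) N₃ εInv ⟩
    (ℓ t * (1ℚ + ε) + minus-a₂ * X₂ - 1ℚ - a₁ * X₁) * (N₃ * εInv)
      ≡⟨ cong (λ y → (y - 1ℚ - a₁ * X₁) * (N₃ * εInv)) (level t) ⟩
    (1ℚ + a₁ * X₁ + c * ε * X₃ - 1ℚ - a₁ * X₁) * (N₃ * εInv)
      ≡⟨ cancel (a₁ * X₁) c ε X₃ N₃ εInv ⟩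
    c * (ε * εInv) * (X₃ * N₃)
      ≡⟨ cong (λ x → c * (ε * εInv) * x) X₃*N₃≡1 ⟩
    c * 1ℚ * 1ℚ
      ≡⟨ trans (*-identityʳ _) (*-identityʳ c) ⟩
    c ∎
    where
    open ≡-Reasoning
    X₁ = + 1 / suc t
    X₂ = (+ 1 / suc t ^ 2) {{m^n≢0 (suc t) 2}}
    X₃ = (+ 1 / suc t ^ 3) {{m^n≢0 (suc t) 3}}
    N₃ = + (suc t ^ 3) / 1
    X₃*N₃≡1 : X₃ * N₃ ≡ 1ℚ
    X₃*N₃≡1 = trans (/-*-/ 1 (suc t ^ 3) (suc t ^ 3) 1 {{m^n≢0 (suc t) 3}} {{_}})
      (/-cross-≡ (1 ℕ.* suc t ^ 3) (suc t ^ 3 ℕ.* 1) 1 1 {{m*n≢0 (suc t ^ 3) 1 {{m^n≢0 (suc t) 3}} {{_}}}} {{_}}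
        (units (suc t ^ 3)))
      where
      units : ∀ n → 1 ℕ.* n ℕ.* 1 ≡ 1 ℕ.* (n ℕ.* 1)
      units = solve-∀
    move : ∀ y a x p n i → (y - 1ℚ - p - (- a) * x) * n * i ≡ (y + a * x - 1ℚ - p) * (n * i)
    move = solve 6 (λ y a x p n i → (y :- con 1ℚ :- p :- (:- a) :* x) :* n :* i := (y :+ a :* x :- con 1ℚ :- p) :* (n :* i)) refl
    cancel : ∀ p c ε X N i → (1ℚ + p + c * ε * X - 1ℚ - p) * (N * i) ≡ c * (ε * i) * (X * N)
    cancel = solve 6 (λ p c ε X N i → (con 1ℚ :+ p :+ c :* ε :* X :- con 1ℚ :- p) :* (N :* i) := c :* (ε :* i) :* (X :* N)) refl

module ChudnovskyLevels where

  open import Data.Nat as ℕ using (zero; suc; _^_)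
  open import Data.Nat.Properties as ℕ using (+-identityʳ; m^n≢0)
  open import Data.Integer using (+_)
  open import Data.Rational using (ℚ; _/_; _+_; _*_; _-_; _≤_; 1ℚ)
  open import Data.Rational.Properties using (≤ᵇ⇒≤; ≤-trans; +-monoʳ-≤; +-monoˡ-≤; module ≤-Reasoning)
  open import Data.Product using (_×_; proj₁; proj₂)
  open import Relation.Binary.PropositionalEquality
  open Polynomials
  open Fractions
  open RationalFunctions
  open AlternatingTails
  open ChudnovskyRatio
  open ChudnovskyTail

  cubic : ℕ → ℕ → ℕ → ℕ → Expr
  cubic c₀ c₁ c₂ c₃ = lit c₀ +ₑ lit c₁ *ₑ var +ₑ lit c₂ *ₑ var ^ₑ 2 +ₑ lit c₃ *ₑ var ^ₑ 3

  -- (n³ + a₁ n² + a₂ n + c ε) / ((1 + ε) n³) with n = t + 1, for c = 0.32161 and c = 0.67035.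
  lowerLevel upperLevel : RExpr
  lowerLevel = cubic 116901782551270248975689685113596809357668021387 350705347653810564634778196325431110988800000000
                     350705347653810652317581950599622406323200000000 116901782551270089199515546413236854835200000000
               ÷ lit 116901782551270858637586169138124917572266700000 *ₑ var+1 ^ₑ 3
  upperLevel = cubic 23380356510254103461904486816534854471318532469 70141069530762112926955639265086222197760000000
                     70141069530762130463516390119924481264640000000 23380356510254017839903109282647370967040000000
               ÷ lit 23380356510254171727517233827624983514453340000 *ₑ var+1 ^ₑ 3

  L U : ℕ → ℚ
  L = ⟦ lowerLevel ⟧ᴿ
  U = ⟦ upperLevel ⟧ᴿ

  one εᴿ a₁ᴿ minus-a₂ᴿ : RExpr
  one       = lit 1 ÷ lit 1
  εᴿ        = lit 1728 ÷ lit (640320 ^ 3)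
  a₁ᴿ       = lit 1 ÷ lit 303862746112002
  minus-a₂ᴿ = lit 62186213362465 ÷ lit 15388761412454497761254741334

  levelLHS : RExpr → RExpr
  levelLHS ℓ = ℓ ⊠ (one ⊞ εᴿ) ⊞ minus-a₂ᴿ ⊠ (lit 1 ÷ var+1 ^ₑ 2)

  levelRHS : RExpr → RExpr
  levelRHS c = one ⊞ a₁ᴿ ⊠ (lit 1 ÷ var+1) ⊞ c ⊠ εᴿ ⊠ (lit 1 ÷ var+1 ^ₑ 3)

  L-isLevel : IsLevel L (+ 32161 / 100000)
  L-isLevel = ≡ᴿ-by-normalisation (levelLHS lowerLevel) (levelRHS (lit 32161 ÷ lit 100000)) _

  U-isLevel : IsLevel U (+ 67035 / 100000)
  U-isLevel = ≡ᴿ-by-normalisation (levelLHS upperLevel) (levelRHS (lit 67035 ÷ lit 100000)) _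

  L≤1 : ∀ t → L t ≤ 1ℚ
  L≤1 = ≤ᴿ-by-normalisation lowerLevel one _

  1≤U+rL : ∀ t → 1ℚ ≤ U t + ratio t * L (suc t)
  1≤U+rL t = subst₂ (λ r l → 1ℚ ≤ U t + r * l) (⟦∘ᴿ⟧ s-ratio var+1 t) (⟦∘ᴿ⟧ lowerLevel var+1 t)
    (≤ᴿ-by-normalisation one (upperLevel ⊞ s-ratio ∘ᴿ var+1 ⊠ lowerLevel ∘ᴿ var+1) _ t)

  L+rU≤1 : ∀ t → L t + ratio t * U (suc t) ≤ 1ℚ
  L+rU≤1 t = subst₂ (λ r u → L t + r * u ≤ 1ℚ) (⟦∘ᴿ⟧ s-ratio var+1 t) (⟦∘ᴿ⟧ upperLevel var+1 t)
    (≤ᴿ-by-normalisation (lowerLevel ⊞ s-ratio ∘ᴿ var+1 ⊠ upperLevel ∘ᴿ var+1) one _ t)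

  normalisedTail-between-levels : ∀ t m → L t - ½^ m ≤ normalisedTail ratio t m × normalisedTail ratio t m ≤ U t + ½^ m
  normalisedTail-between-levels =
    normalisedTail-between ratio 0≤ratio ratio≤½ L U L≤1 (0≤⟦⟧ᴿ upperLevel) 1≤U+rL L+rU≤1

  κᴿ : RExpr
  κᴿ = (one ⊞ εᴿ) ⊠ (var+1 ^ₑ 3 ÷ lit 1) ⊠ (lit (640320 ^ 3) ÷ lit 1728)

  -- κ t = (53360³ + 1) (t + 1)³, so ½^ m κ t ≤ 1/200000 once m reaches this threshold.
  threshold : Expr
  threshold = lit 200000 *ₑ lit 151931373056001 *ₑ var+1 ^ₑ 3

  m≤2^m : ∀ m → m ℕ.≤ 2 ^ m
  m≤2^m zero    = ℕ.z≤n
  m≤2^m (suc m) = subst (suc m ℕ.≤_) (cong (2 ^ m ℕ.+_) (sym (+-identityʳ (2 ^ m))))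
    (ℕ.+-mono-≤ (ℕ.>-nonZero⁻¹ (2 ^ m) {{m^n≢0 2 m}}) (m≤2^m m))

  δ : ℚ
  δ = + 1 / 200000

  ½^*κ≤δ : ∀ t m → ⟦ threshold ⟧ t ℕ.≤ m → ½^ m * κ t ≤ δ
  ½^*κ≤δ t m M≤m = begin
    ½^ m * κ t                 ≤⟨ *-monoʳ-≤-0≤ (0≤⟦⟧ᴿ κᴿ t) ½^m≤1/M ⟩
    (+ 1 / M) {{M≢0}} * κ t    ≤⟨ ≤ᴿ-by-normalisation ((lit 1 ÷ threshold) ⊠ κᴿ) (lit 1 ÷ lit 200000) _ t ⟩
    δ                          ∎
    where
    open ≤-Reasoning
    M = ⟦ threshold ⟧ t
    M≢0 = nonZero-by-normalisation threshold _ t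
    ½^m≤1/M : ½^ m ≤ (+ 1 / M) {{M≢0}}
    ½^m≤1/M = /-cross-≤ 1 (2 ^ m) 1 M {{m^n≢0 2 m}} {{M≢0}}
      (subst₂ ℕ._≤_ (sym (ℕ.*-identityˡ M)) (sym (ℕ.*-identityˡ (2 ^ m))) (ℕ.≤-trans M≤m (m≤2^m m)))

  eApprox-eventually-above : ∀ t m → ⟦ threshold ⟧ t ℕ.≤ m → + 3216 / 10000 + δ ≤ eApprox (suc t) m
  eApprox-eventually-above t m M≤m = begin
    + 3216 / 10000 + δ
      ≤⟨ ≤ᵇ⇒≤ _ ⟩
    + 32161 / 100000 - δ
      ≤⟨ minus-antimonoʳ-≤ (+ 32161 / 100000) (½^*κ≤δ t m M≤m) ⟩
    + 32161 / 100000 - ½^ m * κ t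
      ≤⟨ +-monoʳ-≤ (+ 32161 / 100000) (deviation-below (0≤⟦⟧ᴿ κᴿ t) (proj₁ (normalisedTail-between-levels t m))) ⟩
    + 32161 / 100000 + (v - L t) * κ t
      ≡⟨ cong (λ c → c + (v - L t) * κ t) (e-at-level L (+ 32161 / 100000) L-isLevel t) ⟨
    e t (L t * (1ℚ + ε)) + (v - L t) * κ t
      ≡⟨ trans (eApprox≡e t m) (e-affine t v (L t)) ⟨
    eApprox (suc t) m ∎
    where
    open ≤-Reasoning
    v = normalisedTail ratio t m

  eApprox-eventually-below : ∀ t m → ⟦ threshold ⟧ t ℕ.≤ m → eApprox (suc t) m + δ ≤ + 6704 / 10000
  eApprox-eventually-below t m M≤m = begin
    eApprox (suc t) m + δ
      ≡⟨ cong (_+ δ) (trans (eApprox≡e t m) (e-affine t v (U t))) ⟩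
    e t (U t * (1ℚ + ε)) + (v - U t) * κ t + δ
      ≡⟨ cong (λ c → c + (v - U t) * κ t + δ) (e-at-level U (+ 67035 / 100000) U-isLevel t) ⟩
    + 67035 / 100000 + (v - U t) * κ t + δ
      ≤⟨ +-monoˡ-≤ δ (+-monoʳ-≤ (+ 67035 / 100000)
           (≤-trans (deviation-above (0≤⟦⟧ᴿ κᴿ t) (proj₂ (normalisedTail-between-levels t m))) (½^*κ≤δ t m M≤m))) ⟩
    + 67035 / 100000 + δ + δ
      ≤⟨ ≤ᵇ⇒≤ _ ⟩
    + 6704 / 10000 ∎
    where
    open ≤-Reasoning
    v = normalisedTail ratio t m

open import Data.Integer using (+_)
open import Data.Rational using (_/_)
open import Data.Rational.Properties using (positive⁻¹)
open import Data.Product using (_×_; _,_)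
open Polynomials using (⟦_⟧)
open ChudnovskyLevels

theorem1 : (n : ℕ) → .{{_ : NonZero n}} →
    ((+ 3216 / 10000) <lim eApprox n) × (eApprox n lim< (+ 6704 / 10000))
theorem1 (suc t) = (δ , positive⁻¹ δ , ⟦ threshold ⟧ t , eApprox-eventually-above t)
                 , (δ , positive⁻¹ δ , ⟦ threshold ⟧ t , eApprox-eventually-below t)
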